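{- Let $b$ be a positive integer with $\gcd(b,2)=1$. Then, for either choice of sign, the Diophantine equation $$2^{2x} - b^{y} = \pm 3z^2$$ has no solution in positive integers $(x,y,z)$ with $y$ even and $x>1$. -}

module Defs where

-- Reduce modulo 8. As x > 1, 8 divides 2^(2x); as b is odd and y even, b^y is an odd square,
-- so b^y ≡ 1 (mod 8); and 3z² only takes the residues 0, 3 and 4 mod 8. The equation with +3z²
-- would force 3z² ≡ 2^(2x) - b^y ≡ 7, the one with -3z² would force 3z² ≡ 1.
module Submission where

-- A separate module, so that the operators of ℕ opened here do not clash with those of ℤ below.
module Residues where

  open import Data.Nat
  open import Data.Nat.Coprimality using (gcd≡1⇒coprime)
  open import Data.Nat.DivMod
  open import Data.Nat.Divisibility using (divides; _∣_; ∣-refl; m%n≡0⇒n∣m; n∣m⇒m%n≡0)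
  open import Data.Nat.GCD using (gcd)
  open import Data.Nat.Properties using
    (^-distribˡ-+-*; ^-zeroˡ; ^-*-assoc; *-comm; *-monoʳ-≤; ≤-trans; n≤1+n; m≤n⇒∃[o]m+o≡n; allUpTo?)
  open import Data.Product using (_,_)
  open import Function using (_∘_)
  open import Relation.Binary.PropositionalEquality
  open import Relation.Nullary using (contradiction; ¬?; _→-dec_)
  open import Relation.Nullary.Decidable using (toWitness)
  open ≡-Reasoning

  ^-monoʳ-∣ : ∀ m {n o} → n ≤ o → m ^ n ∣ m ^ o
  ^-monoʳ-∣ m {n} n≤o with k , refl ← m≤n⇒∃[o]m+o≡n n≤o =
    divides (m ^ k) (trans (^-distribˡ-+-* m n k) (*-comm (m ^ n) (m ^ k)))

  %-distribˡ-^ : ∀ m k d .{{_ : NonZero d}} → m ^ k % d ≡ (m % d) ^ k % d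
  %-distribˡ-^ m zero    d = refl
  %-distribˡ-^ m (suc k) d = begin
    m * m ^ k % d                         ≡⟨ %-distribˡ-* m (m ^ k) d ⟩
    (m % d) * (m ^ k % d) % d             ≡⟨ cong (λ u → (m % d) * u % d) (%-distribˡ-^ m k d) ⟩
    (m % d) * ((m % d) ^ k % d) % d       ≡⟨ cong (λ u → u * ((m % d) ^ k % d) % d) (sym (m%n%n≡m%n m d)) ⟩
    (m % d % d) * ((m % d) ^ k % d) % d   ≡⟨ sym (%-distribˡ-* (m % d) ((m % d) ^ k) d) ⟩
    (m % d) * (m % d) ^ k % d             ∎

  %≡1⇒^%≡1 : ∀ m k d .{{_ : NonZero d}} → m % d ≡ 1 % d → m ^ k % d ≡ 1 % d
  %≡1⇒^%≡1 m k d m%d≡1 = begin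
    m ^ k % d            ≡⟨ %-distribˡ-^ m k d ⟩
    (m % d) ^ k % d      ≡⟨ cong (λ u → u ^ k % d) m%d≡1 ⟩
    (1 % d) ^ k % d      ≡⟨ sym (%-distribˡ-^ 1 k d) ⟩
    1 ^ k % d            ≡⟨ cong (_% d) (^-zeroˡ k) ⟩
    1 % d                ∎

  gcd[n,2]≡1⇒n%2≡1 : ∀ n → gcd n 2 ≡ 1 → n % 2 ≡ 1
  gcd[n,2]≡1⇒n%2≡1 n gcd≡1 with n % 2 in n%2≡r | m%n<n n 2
  ... | 0 | _ = contradiction (gcd≡1⇒coprime gcd≡1 (m%n≡0⇒n∣m n 2 n%2≡r , ∣-refl)) λ ()
  ... | 1 | _ = refl
  ... | 2+ _ | s≤s (s≤s ())

  n%2≡1⇒n²%8≡1 : ∀ n → n % 2 ≡ 1 → n ^ 2 % 8 ≡ 1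
  n%2≡1⇒n²%8≡1 n n%2≡1 = trans (%-distribˡ-^ n 2 8) (oddResidue (m%n<n n 8) r%2≡1)
    where
    r%2≡1 : n % 8 % 2 ≡ 1
    r%2≡1 = trans (m∣n⇒o%n%m≡o%m 2 8 n (divides 4 refl)) n%2≡1
    oddResidue : ∀ {r} → r < 8 → r % 2 ≡ 1 → r ^ 2 % 8 ≡ 1
    oddResidue = toWitness {a? = allUpTo? (λ r → (r % 2 ≟ 1) →-dec (r ^ 2 % 8 ≟ 1)) 8} _

  3n²%8≡3[n%8]²%8 : ∀ n → 3 * n ^ 2 % 8 ≡ 3 * (n % 8) ^ 2 % 8
  3n²%8≡3[n%8]²%8 n = begin
    3 * n ^ 2 % 8                 ≡⟨ %-distribˡ-* 3 (n ^ 2) 8 ⟩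
    3 * (n ^ 2 % 8) % 8           ≡⟨ cong (λ u → 3 * u % 8) (%-distribˡ-^ n 2 8) ⟩
    3 * ((n % 8) ^ 2 % 8) % 8     ≡⟨ sym (%-distribˡ-* 3 ((n % 8) ^ 2) 8) ⟩
    3 * (n % 8) ^ 2 % 8           ∎

  3n²%8≢1 : ∀ n → 3 * n ^ 2 % 8 ≢ 1
  3n²%8≢1 n = residues (m%n<n n 8) ∘ trans (sym (3n²%8≡3[n%8]²%8 n))
    where
    residues : ∀ {r} → r < 8 → 3 * r ^ 2 % 8 ≢ 1
    residues = toWitness {a? = allUpTo? (λ r → ¬? (3 * r ^ 2 % 8 ≟ 1)) 8} _

  3n²%8≢7 : ∀ n → 3 * n ^ 2 % 8 ≢ 7
  3n²%8≢7 n = residues (m%n<n n 8) ∘ trans (sym (3n²%8≡3[n%8]²%8 n))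
    where
    residues : ∀ {r} → r < 8 → 3 * r ^ 2 % 8 ≢ 7
    residues = toWitness {a? = allUpTo? (λ r → ¬? (3 * r ^ 2 % 8 ≟ 7)) 8} _

  8∣2^[2x] : ∀ {x} → 1 < x → 8 ∣ 2 ^ (2 * x)
  8∣2^[2x] 1<x = ^-monoʳ-∣ 2 (≤-trans (n≤1+n 3) (*-monoʳ-≤ 2 1<x))

  n%2≡1⇒n^[k*2]%8≡1 : ∀ n k → n % 2 ≡ 1 → n ^ (k * 2) % 8 ≡ 1
  n%2≡1⇒n^[k*2]%8≡1 n k n%2≡1 =
    subst (λ m → m % 8 ≡ 1) (^-*-assoc n k 2) (n%2≡1⇒n²%8≡1 (n ^ k) (%≡1⇒^%≡1 n k 2 n%2≡1))

  p≢q+3z² : ∀ {p q} z → 8 ∣ p → q % 8 ≡ 1 → p ≢ q + 3 * z ^ 2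
  p≢q+3z² {p} {q} z 8∣p q%8≡1 p≡q+3z² = 3n²%8≢7 z (%-pred-≡0 {3 * z ^ 2} {8} (begin
    (1 + 3 * z ^ 2) % 8             ≡⟨ %-distribˡ-+ 1 (3 * z ^ 2) 8 ⟩
    (1 + 3 * z ^ 2 % 8) % 8         ≡⟨ cong (λ r → (r + 3 * z ^ 2 % 8) % 8) (sym q%8≡1) ⟩
    (q % 8 + 3 * z ^ 2 % 8) % 8     ≡⟨ sym (%-distribˡ-+ q (3 * z ^ 2) 8) ⟩
    (q + 3 * z ^ 2) % 8             ≡⟨ cong (_% 8) (sym p≡q+3z²) ⟩
    p % 8                           ≡⟨ n∣m⇒m%n≡0 p 8 8∣p ⟩
    0                               ∎))

  q≢p+3z² : ∀ {p q} z → 8 ∣ p → q % 8 ≡ 1 → q ≢ p + 3 * z ^ 2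
  q≢p+3z² {p} {q} z 8∣p q%8≡1 q≡p+3z² = 3n²%8≢1 z (begin
    3 * z ^ 2 % 8         ≡⟨ sym (%-remove-+ˡ (3 * z ^ 2) 8∣p) ⟩
    (p + 3 * z ^ 2) % 8   ≡⟨ cong (_% 8) (sym q≡p+3z²) ⟩
    q % 8                 ≡⟨ q%8≡1 ⟩
    1                     ∎)

open import Defs
open import Data.Nat using (ℕ; _<_)
open import Data.Nat.GCD using (gcd)
open import Data.Nat.Divisibility using (_∣_)
open import Data.Integer using (ℤ; +_; _-_; _*_; -_; _^_)
open import Data.Product using (_×_)
open import Data.Sum using (_⊎_)
open import Relation.Binary.PropositionalEquality using (_≡_)
open import Relation.Nullary using (¬_)

import Algebra.Properties.AbelianGroup as AbelianGroupProperties
import Data.Nat as ℕ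
open import Data.Nat using (_%_)
import Data.Integer as ℤ
import Data.Integer.Properties as ℤ
open import Data.Nat.Divisibility using (divides)
open import Data.Sum using ([_,_])
open import Function using (_∘_)
open import Relation.Binary.PropositionalEquality using (refl; sym; trans; cong; cong₂; module ≡-Reasoning)
open ≡-Reasoning
open Residues
open AbelianGroupProperties ℤ.+-0-abelianGroup using (//-rightDividesˡ; ⁻¹-anti-homo‿-)

pos-^ : ∀ m n → + (m ℕ.^ n) ≡ (+ m) ^ n
pos-^ m ℕ.zero    = refl
pos-^ m (ℕ.suc n) = trans (ℤ.pos-* m (m ℕ.^ n)) (cong (+ m *_) (pos-^ m n))

i-j≡k⇒i≡j+k : ∀ {i j k} → i - j ≡ k → i ≡ j ℤ.+ k
i-j≡k⇒i≡j+k {i} {j} {k} i-j≡k = begin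
  i               ≡⟨ sym (//-rightDividesˡ j i) ⟩
  (i - j) ℤ.+ j   ≡⟨ cong (ℤ._+ j) i-j≡k ⟩
  k ℤ.+ j         ≡⟨ ℤ.+-comm k j ⟩
  j ℤ.+ k         ∎

i-j≡-k⇒j-i≡k : ∀ {i j k} → i - j ≡ - k → j - i ≡ k
i-j≡-k⇒j-i≡k {i} {j} {k} i-j≡-k = begin
  j - i           ≡⟨ sym (⁻¹-anti-homo‿- i j) ⟩
  - (i - j)       ≡⟨ cong -_ i-j≡-k ⟩
  - - k           ≡⟨ ℤ.neg-involutive k ⟩
  k               ∎

+m-+n≡+o⇒m≡n+o : ∀ {m n o} → + m - + n ≡ + o → m ≡ n ℕ.+ o
+m-+n≡+o⇒m≡n+o {m} {n} = ℤ.+-injective ∘ i-j≡k⇒i≡j+k {+ m} {+ n}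

+m-+n≡-+o⇒n≡m+o : ∀ {m n o} → + m - + n ≡ - + o → n ≡ m ℕ.+ o
+m-+n≡-+o⇒n≡m+o {m} {n} = +m-+n≡+o⇒m≡n+o ∘ i-j≡-k⇒j-i≡k {+ m} {+ n}

proposition3 : (b : ℕ) → 0 < b → gcd b 2 ≡ 1 →
    (x y z : ℕ) → 0 < x → 0 < y → 0 < z → 2 ∣ y → 1 < x →
    ¬ (((+ 2) ^ (2 Data.Nat.* x) - (+ b) ^ y ≡ + 3 * (+ z) ^ 2)
    ⊎ ((+ 2) ^ (2 Data.Nat.* x) - (+ b) ^ y ≡ - (+ 3 * (+ z) ^ 2)))
proposition3 b _ gcd[b,2]≡1 x .(k ℕ.* 2) z _ _ _ (divides k refl) 1<x = [ plus , minus ]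
  where
  P Q : ℕ
  P = 2 ℕ.^ (2 ℕ.* x)
  Q = b ℕ.^ (k ℕ.* 2)

  lhs : (+ 2) ^ (2 ℕ.* x) - (+ b) ^ (k ℕ.* 2) ≡ + P - + Q
  lhs = sym (cong₂ _-_ (pos-^ 2 (2 ℕ.* x)) (pos-^ b (k ℕ.* 2)))

  rhs : + 3 * (+ z) ^ 2 ≡ + (3 ℕ.* z ℕ.^ 2)
  rhs = sym (trans (ℤ.pos-* 3 (z ℕ.^ 2)) (cong (+ 3 *_) (pos-^ z 2)))

  Q%8≡1 : Q % 8 ≡ 1
  Q%8≡1 = n%2≡1⇒n^[k*2]%8≡1 b k (gcd[n,2]≡1⇒n%2≡1 b gcd[b,2]≡1)

  plus : ¬ ((+ 2) ^ (2 ℕ.* x) - (+ b) ^ (k ℕ.* 2) ≡ + 3 * (+ z) ^ 2)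
  plus e = p≢q+3z² {P} {Q} z (8∣2^[2x] 1<x) Q%8≡1
    (+m-+n≡+o⇒m≡n+o {P} {Q} (trans (sym lhs) (trans e rhs)))

  minus : ¬ ((+ 2) ^ (2 ℕ.* x) - (+ b) ^ (k ℕ.* 2) ≡ - (+ 3 * (+ z) ^ 2))
  minus e = q≢p+3z² {P} {Q} z (8∣2^[2x] 1<x) Q%8≡1
    (+m-+n≡-+o⇒n≡m+o {P} {Q} (trans (sym lhs) (trans e (cong -_ rhs))))
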